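{- Let $\phi:\{0,1\}^*\to\{0,1\}^*$ be the morphism $0\mapsto 00101$, $1\mapsto 11011$, and let $\Phi=\lim_{n\to\infty}\phi^n(0)$ be its fixed point beginning with $0$. Then $\Phi$ has the Frobenius property.
   Context: For an infinite word $\mathbf{w}$, $\mathcal{L}_{\mathbf{w}}$ denotes its set of (finite) factors. A semigroup homomorphism $S:\{0,1\}^*\to\mathbb{N}$ is determined by $S(0),S(1)$ via $S(uv)=S(u)+S(v)$, and $S(\mathcal{L}_{\mathbf{w}})=\{S(u):u\in\mathcal{L}_{\mathbf{w}}\}$. An infinite binary word $\mathbf{w}$ has the Frobenius property if for every such $S$ with $S(0),S(1)$ non-negative integers satisfying $\gcd(S(0),S(1))=1$, the set $S(\mathcal{L}_{\mathbf{w}})$ contains all but finitely many elements of $\mathbb{N}$. -}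

module Defs where

open import Data.Nat using (ℕ; zero; suc; _+_; _≤_)
open import Data.Nat.GCD using (gcd)
open import Data.Bool using (Bool; true; false)
open import Data.List using (List; []; _∷_; concatMap)
open import Data.Product using (∃; ∃-syntax; _×_)
open import Relation.Binary.PropositionalEquality using (_≡_)

-- Binary alphabet {0,1}: false encodes the letter 0, true encodes the letter 1.
Letter : Set
Letter = Bool

InfWord : Set
InfWord = ℕ → Letter

φ₁ : Letter → List Letter
φ₁ false = false ∷ false ∷ true ∷ false ∷ true ∷ []
φ₁ true  = true ∷ true ∷ false ∷ true ∷ true ∷ []

φ : List Letter → List Letter
φ = concatMap φ₁

φ^_[0] : ℕ → List Letter
φ^ zero  [0] = false ∷ []
φ^ suc n [0] = φ (φ^ n [0])

-- k-th letter of a finite word (default 0 if out of range; never used out of range below).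
nth : List Letter → ℕ → Letter
nth []       _       = false
nth (x ∷ xs) zero    = x
nth (x ∷ xs) (suc k) = nth xs k

-- The fixed point Φ = lim φⁿ(0): since φⁿ(0) is a prefix of φⁿ⁺¹(0) and
-- |φⁿ(0)| = 5ⁿ, the k-th letter of Φ is the k-th letter of φᵏ⁺¹(0).
Φ : InfWord
Φ k = nth (φ^ suc k [0]) k

factor : InfWord → ℕ → ℕ → List Letter
factor w i zero    = []
factor w i (suc n) = w i ∷ factor w (suc i) n

S : ℕ → ℕ → List Letter → ℕ
S a b []           = 0
S a b (false ∷ u)  = a + S a b u
S a b (true ∷ u)   = b + S a b u

_∈S[_,_]L_ : ℕ → ℕ → ℕ → InfWord → Set
m ∈S[ a , b ]L w = ∃[ i ] ∃[ n ] S a b (factor w i n) ≡ m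

-- Frobenius property: for all a, b with gcd(a,b) = 1, S(L_w) contains all
-- but finitely many naturals, i.e. all naturals from some N on.
FrobeniusProperty : InfWord → Set
FrobeniusProperty w =
  (a b : ℕ) → gcd a b ≡ 1 → ∃[ N ] ((m : ℕ) → N ≤ m → m ∈S[ a , b ]L w)

module Submission where

-- If S(0) = a, S(1) = b, let x be the heavier letter, p = min(a,b), d = |a − b|:
-- then S(u) = p·|u| + d·#ₓ(u) and gcd(p,d) = 1, so every large m must be written
-- as p·n + d·c with c = #ₓ of some factor of Φ of length n.  Two facts suffice:
--   * sliding a window one step changes #ₓ by ≤ 1, so every value between two
--     counts at length n is a count at length n (discrete IVT);
--   * Φ has windows: for each D, positions P₀ ≤ P₁ whose counts differ by ≥ D at
--     all lengths in [L, L + len], len arbitrary.  They come from two positions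
--     with different letters followed by a long common block, blown up by φ,
--     which doubles the difference.
-- By Bézout, m = p·n₀ + d·K with n₀ bounded and K large; a suitable s makes the
-- length n₀ + d·s and the count K − p·s fit a window.

open import Defs
open import Data.Nat
open import Data.Nat.Properties
open import Data.Nat.DivMod using (_%_; _/_; m%n<n; m≡m%n+[m/n]*n; m*n/n≡m; /-monoˡ-≤)
open import Data.Nat.GCD using (gcd; GCD; gcd-GCD; gcd[m,n]∣m; gcd[m,n]∣n; gcd-greatest; gcd-comm; gcd-identityʳ; module Bézout)
open import Data.Nat.Divisibility using (_∣_; ∣-antisym; ∣m∸n∣n⇒∣m; ∣m+n∣m⇒∣n)
open import Data.Bool using (true; false)
open import Data.List using (List; []; _∷_; _++_; length)
open import Data.List.Properties using (++-assoc; length-++; ∷-injectiveˡ; ∷-injectiveʳ)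
open import Data.Product using (∃-syntax; _×_; _,_; proj₁; proj₂)
open import Data.Sum using (inj₁; inj₂)
open import Relation.Nullary using (yes; no)
open import Relation.Binary.PropositionalEquality
open import Data.Nat.Tactic.RingSolver using (solve-∀)

δ : Letter → Letter → ℕ
δ false false = 1
δ false true  = 0
δ true  false = 0
δ true  true  = 1

flip : Letter → Letter
flip false = true
flip true  = false

occ : Letter → List Letter → ℕ
occ x []      = 0
occ x (y ∷ u) = δ x y + occ x u

occ-++ : ∀ x u v → occ x (u ++ v) ≡ occ x u + occ x v
occ-++ x []      v = refl
occ-++ x (y ∷ u) v = trans (cong (δ x y +_) (occ-++ x u v)) (sym (+-assoc (δ x y) _ _))

δ≤1 : ∀ x y → δ x y ≤ 1
δ≤1 false false = ≤-refl
δ≤1 false true  = z≤n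
δ≤1 true  false = z≤n
δ≤1 true  true  = ≤-refl

occ≤length : ∀ x u → occ x u ≤ length u
occ≤length x []      = z≤n
occ≤length x (y ∷ u) = +-mono-≤ (δ≤1 x y) (occ≤length x u)

S-counts : ∀ a b u → S a b u ≡ a * occ false u + b * occ true u
S-counts a b []          = sym (cong₂ _+_ (*-zeroʳ a) (*-zeroʳ b))
S-counts a b (false ∷ u) = trans (cong (a +_) (S-counts a b u)) (shift a b (occ false u) (occ true u))
  where
  shift : ∀ a b m n → a + (a * m + b * n) ≡ a * (1 + m) + b * (0 + n)
  shift = solve-∀
S-counts a b (true ∷ u)  = trans (cong (b +_) (S-counts a b u)) (shift a b (occ false u) (occ true u))
  where
  shift : ∀ a b m n → b + (a * m + b * n) ≡ a * (0 + m) + b * (1 + n)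
  shift = solve-∀

length-counts : ∀ u → length u ≡ occ false u + occ true u
length-counts []          = refl
length-counts (false ∷ u) = cong suc (length-counts u)
length-counts (true ∷ u)  = trans (cong suc (length-counts u)) (sym (+-suc (occ false u) (occ true u)))

gcd-∸ : ∀ {a b} → a ≤ b → gcd a (b ∸ a) ≡ gcd a b
gcd-∸ {a} {b} a≤b = ∣-antisym
  (gcd-greatest (gcd[m,n]∣m a (b ∸ a)) (∣m∸n∣n⇒∣m _ a≤b (gcd[m,n]∣n a (b ∸ a)) (gcd[m,n]∣m a (b ∸ a))))
  (gcd-greatest (gcd[m,n]∣m a b)
    (∣m+n∣m⇒∣n (subst (gcd a b ∣_) (sym (m+[n∸m]≡n a≤b)) (gcd[m,n]∣n a b)) (gcd[m,n]∣m a b)))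

weights : ∀ a b → ∃[ x ] ∃[ p ] ∃[ d ]
            (gcd p d ≡ gcd a b × (∀ u → S a b u ≡ p * length u + d * occ x u))
weights a b with ≤-total a b
... | inj₁ a≤b = true , a , b ∸ a , gcd-∸ a≤b , λ u → begin
      S a b u                                      ≡⟨ S-counts a b u ⟩
      a * occ false u + b * occ true u             ≡⟨ cong (λ c → a * occ false u + c * occ true u) (sym (m+[n∸m]≡n a≤b)) ⟩
      a * occ false u + (a + (b ∸ a)) * occ true u ≡⟨ regroup a (b ∸ a) (occ false u) (occ true u) ⟩
      a * (occ false u + occ true u) + (b ∸ a) * occ true u ≡⟨ cong (λ l → a * l + (b ∸ a) * occ true u) (sym (length-counts u)) ⟩
      a * length u + (b ∸ a) * occ true u          ∎
  where
  open ≡-Reasoning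
  regroup : ∀ p d m n → p * m + (p + d) * n ≡ p * (m + n) + d * n
  regroup = solve-∀
... | inj₂ b≤a = false , b , a ∸ b , trans (gcd-∸ b≤a) (gcd-comm b a) , λ u → begin
      S a b u                                      ≡⟨ S-counts a b u ⟩
      a * occ false u + b * occ true u             ≡⟨ cong (λ c → c * occ false u + b * occ true u) (sym (m+[n∸m]≡n b≤a)) ⟩
      (b + (a ∸ b)) * occ false u + b * occ true u ≡⟨ regroup b (a ∸ b) (occ false u) (occ true u) ⟩
      b * (occ false u + occ true u) + (a ∸ b) * occ false u ≡⟨ cong (λ l → b * l + (a ∸ b) * occ false u) (sym (length-counts u)) ⟩
      b * length u + (a ∸ b) * occ false u         ∎
  where
  open ≡-Reasoning
  regroup : ∀ p d m n → (p + d) * m + p * n ≡ p * (m + n) + d * m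
  regroup = solve-∀

length-factor : ∀ w i n → length (factor w i n) ≡ n
length-factor w i zero    = refl
length-factor w i (suc n) = cong suc (length-factor w (suc i) n)

factor-++ : ∀ w i n k → factor w i (n + k) ≡ factor w i n ++ factor w (n + i) k
factor-++ w i zero    k = refl
factor-++ w i (suc n) k =
  cong (w i ∷_) (trans (factor-++ w (suc i) n k) (cong (λ j → factor w (suc i) n ++ factor w j k) (+-suc n i)))

factor-prefix : ∀ w i j n t → t ≤ n → factor w i n ≡ factor w j n → factor w i t ≡ factor w j t
factor-prefix w i j n       zero    _         _  = refl
factor-prefix w i j (suc n) (suc t) (s≤s t≤n) eq =
  cong₂ _∷_ (∷-injectiveˡ eq) (factor-prefix w (suc i) (suc j) n t t≤n (∷-injectiveʳ eq))

count : Letter → InfWord → ℕ → ℕ → ℕ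
count x w i n = occ x (factor w i n)

count≤length : ∀ x w i n → count x w i n ≤ n
count≤length x w i n = subst (count x w i n ≤_) (length-factor w i n) (occ≤length x (factor w i n))

count-++ : ∀ x w i n k → count x w i (n + k) ≡ count x w i n + count x w (n + i) k
count-++ x w i n k = trans (cong (occ x) (factor-++ w i n k)) (occ-++ x (factor w i n) (factor w (n + i) k))

count-extend : ∀ x w i n k → count x w i (n + k) ≤ count x w i n + k
count-extend x w i n k =
  subst (_≤ count x w i n + k) (sym (count-++ x w i n k)) (+-monoʳ-≤ (count x w i n) (count≤length x w (n + i) k))

count-step : ∀ x w i n → count x w i (suc n) ≤ suc (count x w i n)
count-step x w i n = begin
  count x w i (suc n)   ≡⟨ cong (count x w i) (+-comm 1 n) ⟩
  count x w i (n + 1)   ≤⟨ count-extend x w i n 1 ⟩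
  count x w i n + 1     ≡⟨ +-comm (count x w i n) 1 ⟩
  suc (count x w i n)   ∎
  where open ≤-Reasoning

count-shift : ∀ x w i n → count x w (suc i) n ≤ suc (count x w i n)
count-shift x w i n = ≤-trans (m≤n+m (count x w (suc i) n) (δ x (w i))) (count-step x w i n)

-- Discrete intermediate values

-- If G rises by at most D + 1 per step and passes K between a and t + a, then some s
-- in that range has K in [G s, D + G s]: take the first s with K ≤ D + G s.
crossing-from : (G : ℕ → ℕ) (D : ℕ) → (∀ s → G (suc s) ≤ suc (D + G s)) →
                ∀ {K} t a → G a ≤ K → K ≤ G (t + a) →
                ∃[ s ] (a ≤ s × s ≤ t + a × G s ≤ K × K ≤ D + G s)
crossing-from G D step zero    a below above = a , ≤-refl , ≤-refl , below , ≤-trans above (m≤n+m (G a) D)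
crossing-from G D step {K} (suc t) a below above with K ≤? D + G a
... | yes reached = a , ≤-refl , m≤n+m a (suc t) , below , reached
... | no passed
  with crossing-from G D step t (suc a) (≤-trans (step a) (≰⇒> passed)) (subst (λ i → K ≤ G i) (sym (+-suc t a)) above)
...   | s , a<s , s≤ , lower , upper = s , ≤-trans (n≤1+n a) a<s , subst (s ≤_) (+-suc t a) s≤ , lower , upper

crossing : (G : ℕ → ℕ) (D : ℕ) → (∀ s → G (suc s) ≤ suc (D + G s)) →
           ∀ {a b K} → a ≤ b → G a ≤ K → K ≤ G b →
           ∃[ s ] (a ≤ s × s ≤ b × G s ≤ K × K ≤ D + G s)
crossing G D step {a} {b} {K} a≤b below above
  with crossing-from G D step (b ∸ a) a below (subst (λ i → K ≤ G i) (sym (m∸n+n≡m a≤b)) above)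
... | s , a≤s , s≤ , lower , upper = s , a≤s , subst (s ≤_) (m∸n+n≡m a≤b) s≤ , lower , upper

unit-steps-hit : (G : ℕ → ℕ) → (∀ s → G (suc s) ≤ suc (G s)) →
                 ∀ {a b K} → a ≤ b → G a ≤ K → K ≤ G b → ∃[ s ] G s ≡ K
unit-steps-hit G step a≤b below above with crossing G 0 step a≤b below above
... | s , _ , _ , lower , upper = s , ≤-antisym lower upper

-- From windows to the Frobenius-type property, for an arbitrary word

Representable : Letter → InfWord → ℕ → ℕ → ℕ → Set
Representable x w p d m = ∃[ j ] ∃[ n ] p * n + d * count x w j n ≡ m

EventuallyRepresentable : Letter → InfWord → ℕ → ℕ → Set
EventuallyRepresentable x w p d = ∃[ N ] (∀ m → N ≤ m → Representable x w p d m)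

Gap : Letter → InfWord → ℕ → ℕ → ℕ → ℕ → ℕ → Set
Gap x w D L len P₀ P₁ = P₀ ≤ P₁ × (∀ t → t ≤ len → D + count x w P₀ (L + t) ≤ count x w P₁ (L + t))

Windows : Letter → InfWord → Set
Windows x w = ∀ D → ∃[ L ] (∀ len → ∃[ P₀ ] ∃[ P₁ ] Gap x w D L len P₀ P₁)

gap-realises : ∀ {x w D L len P₀ P₁} → Gap x w D L len P₀ P₁ →
               ∀ {n k} → L ≤ n → n ≤ L + len → count x w P₀ n ≤ k → k ≤ D + count x w P₀ n →
               ∃[ j ] count x w j n ≡ k
gap-realises {x} {w} {D} {L} {len} {P₀} {P₁} (P₀≤P₁ , gap) {n} {k} L≤n n≤ below above =
  unit-steps-hit (λ j → count x w j n) (λ j → count-shift x w j n) P₀≤P₁ below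
    (≤-trans above (subst (λ l → D + count x w P₀ l ≤ count x w P₁ l) (m+[n∸m]≡n L≤n)
      (gap (n ∸ L) (m≤n+o⇒m∸n≤o n L n≤))))

-- Windows make the counts unbounded, so every m is a count.
windows-hit-all : ∀ {x w} → Windows x w → ∀ m → ∃[ j ] ∃[ n ] count x w j n ≡ m
windows-hit-all {x} {w} windows m with windows m
... | L , gaps with gaps 0
...   | P₀ , P₁ , _ , gap =
  P₁ , unit-steps-hit (count x w P₁) (count-step x w P₁) (z≤n {L + 0}) z≤n
         (≤-trans (m≤m+n m _) (gap 0 z≤n))

-- Choosing the length.  For a sliding count c, s ↦ c(n₀ + d·s) + p·s rises by at most
-- p + d per step, is ≤ K at s = L and ≥ K at s = K; so at some s in [L, K] it lies
-- within p + d below K.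
balanced-length : (c : ℕ → ℕ) → (∀ n → c n ≤ n) → (∀ n k → c (n + k) ≤ c n + k) →
                  ∀ p d n₀ L K → 1 ≤ p → n₀ + d * L + p * L ≤ K →
                  ∃[ s ] (L ≤ s × s ≤ K × c (n₀ + d * s) + p * s ≤ K × K ≤ (p + d) + (c (n₀ + d * s) + p * s))
balanced-length c c≤ c-extend p d n₀ L K 1≤p big = crossing G (p + d) step L≤K GL≤K K≤GK
  where
  G : ℕ → ℕ
  G s = c (n₀ + d * s) + p * s
  step : ∀ s → G (suc s) ≤ suc (p + d + G s)
  step s = begin
    c (n₀ + d * suc s) + p * suc s ≡⟨ cong₂ (λ l r → c l + r) (unfold n₀ d s) (*-suc p s) ⟩
    c (n₀ + d * s + d) + (p + p * s) ≤⟨ +-monoˡ-≤ (p + p * s) (c-extend (n₀ + d * s) d) ⟩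
    c (n₀ + d * s) + d + (p + p * s) ≡⟨ regroup (c (n₀ + d * s)) d p (p * s) ⟩
    p + d + G s                      ≤⟨ n≤1+n _ ⟩
    suc (p + d + G s)                ∎
    where
    open ≤-Reasoning
    unfold : ∀ n₀ d s → n₀ + d * suc s ≡ n₀ + d * s + d
    unfold = solve-∀
    regroup : ∀ c d p ps → c + d + (p + ps) ≡ p + d + (c + ps)
    regroup = solve-∀
  ≤p* : ∀ k → k ≤ p * k
  ≤p* k = subst (_≤ p * k) (*-identityˡ k) (*-monoˡ-≤ k 1≤p)
  L≤K : L ≤ K
  L≤K = ≤-trans (≤p* L) (≤-trans (m≤n+m (p * L) (n₀ + d * L)) big)
  GL≤K : G L ≤ K
  GL≤K = ≤-trans (+-monoˡ-≤ (p * L) (c≤ (n₀ + d * L))) big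
  K≤GK : K ≤ G K
  K≤GK = ≤-trans (≤p* K) (m≤n+m (p * K) _)

bezout : ∀ p d → .{{NonZero p}} → .{{NonZero d}} → gcd p d ≡ 1 → ∃[ u ] ∃[ v ] p * u ≡ 1 + d * v
bezout (suc p) 1 _ = 1 , p , cong suc (trans (*-identityʳ p) (sym (+-identityʳ p)))
bezout p d@(suc (suc e)) g with Bézout.identity (subst (GCD p d) g (gcd-GCD p d))
... | Bézout.+- x y eq = x , y , trans (*-comm p x) (trans (sym eq) (cong (1 +_) (*-comm y d)))
... | Bézout.-+ x zero ()
... | Bézout.-+ x (suc y) eq =
  -- from 1 + x·p = (y + 1)·d, multiply by d − 1 = e + 1 and cancel e + 1
  x * suc e , e + y * suc e ,
  +-cancelʳ-≡ (suc e) _ _ (trans (lhs p x e) (trans (cong (_* suc e) eq) (rhs y e)))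
  where
  lhs : ∀ p x e → p * (x * suc e) + suc e ≡ (1 + x * p) * suc e
  lhs = solve-∀
  rhs : ∀ y e → suc y * suc (suc e) * suc e ≡ 1 + suc (suc e) * (e + y * suc e) + suc e
  rhs = solve-∀

-- Every m ≥ d·(v·d + T) splits as m = p·n₀ + d·K with n₀ ≤ u·d and K ≥ T
-- (take the residue r of m mod d and n₀ = u·r).
bezout-split : ∀ p d u v T m → .{{NonZero d}} → p * u ≡ 1 + d * v → d * (v * d + T) ≤ m →
               ∃[ n₀ ] ∃[ K ] (n₀ ≤ u * d × T ≤ K × m ≡ p * n₀ + d * K)
bezout-split p d u v T m bez big = u * r , q ∸ v * r , *-monoʳ-≤ u (<⇒≤ r<d) , T≤K , split
  where
  r = m % d
  q = m / d
  r<d : r < d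
  r<d = m%n<n m d
  vd+T≤q : v * d + T ≤ q
  vd+T≤q = subst (_≤ q) (m*n/n≡m (v * d + T) d) (/-monoˡ-≤ d (subst (_≤ m) (*-comm d _) big))
  T+vr≤q : T + v * r ≤ q
  T+vr≤q = ≤-trans (≤-reflexive (+-comm T (v * r))) (≤-trans (+-monoˡ-≤ T (*-monoʳ-≤ v (<⇒≤ r<d))) vd+T≤q)
  T≤K : T ≤ q ∸ v * r
  T≤K = m+n≤o⇒m≤o∸n T T+vr≤q
  split : m ≡ p * (u * r) + d * (q ∸ v * r)
  split = begin
    m                                  ≡⟨ m≡m%n+[m/n]*n m d ⟩
    r + q * d                          ≡⟨ cong (λ z → r + z * d) (sym (m+[n∸m]≡n (m+n≤o⇒n≤o T T+vr≤q))) ⟩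
    r + (v * r + (q ∸ v * r)) * d      ≡⟨ regroup r v (q ∸ v * r) d ⟩
    (1 + d * v) * r + d * (q ∸ v * r)  ≡⟨ cong (λ z → z * r + d * (q ∸ v * r)) (sym bez) ⟩
    p * u * r + d * (q ∸ v * r)        ≡⟨ cong (_+ d * (q ∸ v * r)) (*-assoc p u r) ⟩
    p * (u * r) + d * (q ∸ v * r)      ∎
    where
    open ≡-Reasoning
    regroup : ∀ r v K d → r + (v * r + K) * d ≡ (1 + d * v) * r + d * K
    regroup = solve-∀

-- The core step: a split m = p·n₀ + d·K with K large enough for a gap of size p + d
-- is representable.  Length n = n₀ + d·s and count K − p·s, with s from balanced-length.
split-representable : ∀ {x w L len P₀ P₁} p d n₀ K → .{{NonZero p}} → .{{NonZero d}} →
                      Gap x w (p + d) L len P₀ P₁ →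
                      n₀ + d * L + p * L ≤ K → n₀ + d * K ≤ L + len →
                      Representable x w p d (p * n₀ + d * K)
split-representable {x} {w} {L} {len} {P₀} p d n₀ K gap big fits
  with balanced-length (count x w P₀) (count≤length x w P₀) (count-extend x w P₀) p d n₀ L K (>-nonZero⁻¹ p) big
... | s , L≤s , s≤K , lower , upper = realise (gap-realises gap L≤n n≤ c≤k k≤)
  where
  n = n₀ + d * s
  c = count x w P₀ n
  L≤n : L ≤ n
  L≤n = ≤-trans L≤s (≤-trans (m≤n*m s d) (m≤n+m (d * s) n₀))
  n≤ : n ≤ L + len
  n≤ = ≤-trans (+-monoʳ-≤ n₀ (*-monoʳ-≤ d s≤K)) fits
  c≤k : c ≤ K ∸ p * s
  c≤k = m+n≤o⇒m≤o∸n c lower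
  k≤ : K ∸ p * s ≤ p + d + c
  k≤ = m≤n+o⇒m∸n≤o K (p * s) (≤-trans upper (≤-reflexive (regroup (p + d) c (p * s))))
    where
    regroup : ∀ a c b → a + (c + b) ≡ b + (a + c)
    regroup = solve-∀
  realise : ∃[ j ] count x w j n ≡ K ∸ p * s → Representable x w p d (p * n₀ + d * K)
  realise (j , hit) = j , n , (begin
    p * n + d * count x w j n            ≡⟨ cong (λ k → p * n + d * k) hit ⟩
    p * (n₀ + d * s) + d * (K ∸ p * s)   ≡⟨ regroup p n₀ d s (K ∸ p * s) ⟩
    p * n₀ + d * (p * s + (K ∸ p * s))   ≡⟨ cong (λ k → p * n₀ + d * k) (m+[n∸m]≡n (m+n≤o⇒n≤o c lower)) ⟩
    p * n₀ + d * K                       ∎)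
    where
    open ≡-Reasoning
    regroup : ∀ p n₀ d s k → p * (n₀ + d * s) + d * k ≡ p * n₀ + d * (p * s + k)
    regroup = solve-∀

frobenius-from-windows : ∀ {x w} → Windows x w → ∀ p d u v → .{{NonZero p}} → .{{NonZero d}} →
                         p * u ≡ 1 + d * v → EventuallyRepresentable x w p d
frobenius-from-windows {x} {w} windows p d u v bez = d * (v * d + T) , represent
  where
  L = proj₁ (windows (p + d))
  T = u * d + d * L + p * L
  represent : ∀ m → d * (v * d + T) ≤ m → Representable x w p d m
  represent m big with bezout-split p d u v T m bez big
  ... | n₀ , K , n₀≤ud , T≤K , m≡ with proj₂ (windows (p + d)) (u * d + m)
  ...   | P₀ , P₁ , gap = subst (Representable x w p d) (sym m≡)
          (split-representable p d n₀ K gap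
            (≤-trans (+-monoˡ-≤ (p * L) (+-monoˡ-≤ (d * L) n₀≤ud)) T≤K)
            (≤-trans (+-mono-≤ n₀≤ud (≤-trans (m≤n+m (d * K) (p * n₀)) (≤-reflexive (sym m≡))))
                     (m≤n+m (u * d + m) L)))

frobenius-counts : ∀ {x w} → Windows x w → ∀ p d → gcd p d ≡ 1 → EventuallyRepresentable x w p d
frobenius-counts windows p zero g = 0 , λ m _ → 0 , m ,
  trans (+-identityʳ (p * m)) (trans (cong (_* m) (trans (sym (gcd-identityʳ p)) g)) (*-identityˡ m))
frobenius-counts {x} {w} windows zero d@(suc _) g with windows-hit-all windows
... | hit = 0 , λ m _ → let j , n , eq = hit m in
  j , n , trans (cong (_* count x w j n) g) (trans (*-identityˡ (count x w j n)) eq)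
frobenius-counts windows p@(suc _) d@(suc _) g with bezout p d g
... | u , v , bez = frobenius-from-windows windows p d u v bez

-- Self-similarity of Φ

n<b^n : ∀ b → 1 < b → ∀ n → n < b ^ n
n<b^n b 1<b zero    = s≤s z≤n
n<b^n b 1<b (suc n) = ≤-<-trans (n<b^n b 1<b n) (^-monoʳ-< b 1<b (n<1+n n))

n<5^n : ∀ n → n < 5 ^ n
n<5^n = n<b^n 5 (s≤s (s≤s z≤n))

length-φ₁ : ∀ y → length (φ₁ y) ≡ 5
length-φ₁ false = refl
length-φ₁ true  = refl

length-φ : ∀ u → length (φ u) ≡ 5 * length u
length-φ []      = refl
length-φ (y ∷ u) = trans (length-++ (φ₁ y)) (trans (cong₂ _+_ (length-φ₁ y) (length-φ u)) (sym (*-suc 5 (length u))))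

φ-++ : ∀ u v → φ (u ++ v) ≡ φ u ++ φ v
φ-++ []      v = refl
φ-++ (y ∷ u) v = trans (cong (φ₁ y ++_) (φ-++ u v)) (sym (++-assoc (φ₁ y) (φ u) (φ v)))

nth-++ˡ : ∀ u v k → k < length u → nth (u ++ v) k ≡ nth u k
nth-++ˡ (y ∷ u) v zero    _         = refl
nth-++ˡ (y ∷ u) v (suc k) (s≤s k<) = nth-++ˡ u v k k<

nth-++ʳ : ∀ u v k → nth (u ++ v) (length u + k) ≡ nth v k
nth-++ʳ []      v k = refl
nth-++ʳ (y ∷ u) v k = nth-++ʳ u v k

length-iterate : ∀ s → length (φ^ s [0]) ≡ 5 ^ s
length-iterate zero    = refl
length-iterate (suc s) = trans (length-φ (φ^ s [0])) (cong (5 *_) (length-iterate s))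

iterate-grows : ∀ s → ∃[ r ] φ^ suc s [0] ≡ φ^ s [0] ++ r
iterate-grows zero    = false ∷ true ∷ false ∷ true ∷ [] , refl
iterate-grows (suc s) with iterate-grows s
... | r , eq = φ r , trans (cong φ eq) (φ-++ (φ^ s [0]) r)

iterate-stable : ∀ t s k → k < 5 ^ s → nth (φ^ s [0]) k ≡ nth (φ^ (t + s) [0]) k
iterate-stable zero    s k k< = refl
iterate-stable (suc t) s k k< with iterate-grows (t + s)
... | r , eq = trans (iterate-stable t s k k<)
  (sym (trans (cong (λ u → nth u k) eq) (nth-++ˡ (φ^ t + s [0]) r k
    (subst (k <_) (sym (length-iterate (t + s))) (<-≤-trans k< (^-monoʳ-≤ 5 (m≤n+m s t)))))))

iterate-Φ : ∀ s k → k < 5 ^ s → nth (φ^ s [0]) k ≡ Φ k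
iterate-Φ s k k< = trans (iterate-stable (suc k) s k k<)
  (trans (cong (λ e → nth (φ^ e [0]) k) (+-comm (suc k) s))
    (sym (iterate-stable s (suc k) k (<-trans (n<1+n k) (n<5^n (suc k))))))

nth-φ : ∀ u q r → q < length u → r < 5 → nth (φ u) (r + q * 5) ≡ nth (φ₁ (nth u q)) r
nth-φ (y ∷ u) zero    r _        r<5 rewrite +-identityʳ r =
  nth-++ˡ (φ₁ y) (φ u) r (subst (r <_) (sym (length-φ₁ y)) r<5)
nth-φ (y ∷ u) (suc q) r (s≤s q<) r<5 = begin
  nth (φ₁ y ++ φ u) (r + (5 + q * 5))          ≡⟨ cong (nth (φ₁ y ++ φ u)) (regroup r q) ⟩
  nth (φ₁ y ++ φ u) (5 + (r + q * 5))          ≡⟨ cong (λ l → nth (φ₁ y ++ φ u) (l + (r + q * 5))) (sym (length-φ₁ y)) ⟩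
  nth (φ₁ y ++ φ u) (length (φ₁ y) + (r + q * 5)) ≡⟨ nth-++ʳ (φ₁ y) (φ u) (r + q * 5) ⟩
  nth (φ u) (r + q * 5)                        ≡⟨ nth-φ u q r q< r<5 ⟩
  nth (φ₁ (nth u q)) r                         ∎
  where
  open ≡-Reasoning
  regroup : ∀ r q → r + (5 + q * 5) ≡ 5 + (r + q * 5)
  regroup = solve-∀

self-similarity : ∀ q r → r < 5 → Φ (r + q * 5) ≡ nth (φ₁ (Φ q)) r
self-similarity q r r<5 = begin
  Φ (r + q * 5)                          ≡⟨ sym (iterate-Φ (suc q) (r + q * 5) in-range) ⟩
  nth (φ (φ^ q [0])) (r + q * 5)         ≡⟨ nth-φ (φ^ q [0]) q r (subst (q <_) (sym (length-iterate q)) (n<5^n q)) r<5 ⟩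
  nth (φ₁ (nth (φ^ q [0]) q)) r          ≡⟨ cong (λ y → nth (φ₁ y) r) (iterate-Φ q q (n<5^n q)) ⟩
  nth (φ₁ (Φ q)) r                       ∎
  where
  open ≡-Reasoning
  in-range : r + q * 5 < 5 * 5 ^ q
  in-range = <-≤-trans (+-monoˡ-< (q * 5) r<5)
    (subst (_≤ 5 * 5 ^ q) (*-comm 5 (suc q)) (*-monoʳ-≤ 5 (n<5^n q)))

factor-from-nth : ∀ w i n u → length u ≡ n → (∀ r → r < n → w (r + i) ≡ nth u r) → factor w i n ≡ u
factor-from-nth w i zero    []      _  _      = refl
factor-from-nth w i (suc n) (y ∷ u) eq letters =
  cong₂ _∷_ (letters 0 (s≤s z≤n))
    (factor-from-nth w (suc i) n u (suc-injective eq)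
      (λ r r< → trans (cong w (+-suc r i)) (letters (suc r) (s≤s r<))))

block : ∀ q → factor Φ (q * 5) 5 ≡ φ₁ (Φ q)
block q = factor-from-nth Φ (q * 5) 5 (φ₁ (Φ q)) (length-φ₁ (Φ q)) (λ r r< → self-similarity q r r<)

factor-image : ∀ q n → factor Φ (q * 5) (n * 5) ≡ φ (factor Φ q n)
factor-image q zero    = refl
factor-image q (suc n) =
  trans (factor-++ Φ (q * 5) 5 (n * 5)) (cong₂ _++_ (block q) (factor-image (suc q) n))

-- blockMin x = number of x's in the φ-image of the other letter; φ(x) has two more.
blockMin : Letter → ℕ
blockMin false = 1
blockMin true  = 2

occ-φ : ∀ x u → occ x (φ u) ≡ blockMin x * length u + 2 * occ x u
occ-φ x []      = sym (trans (+-identityʳ _) (*-zeroʳ (blockMin x)))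
occ-φ x (y ∷ u) = begin
  occ x (φ₁ y ++ φ u)                                      ≡⟨ occ-++ x (φ₁ y) (φ u) ⟩
  occ x (φ₁ y) + occ x (φ u)                               ≡⟨ cong₂ _+_ (occ-φ₁ x y) (occ-φ x u) ⟩
  (blockMin x + 2 * δ x y) + (blockMin x * length u + 2 * occ x u) ≡⟨ regroup (blockMin x) (δ x y) (length u) (occ x u) ⟩
  blockMin x * suc (length u) + 2 * (δ x y + occ x u)      ∎
  where
  open ≡-Reasoning
  occ-φ₁ : ∀ x y → occ x (φ₁ y) ≡ blockMin x + 2 * δ x y
  occ-φ₁ false false = refl
  occ-φ₁ false true  = refl
  occ-φ₁ true  false = refl
  occ-φ₁ true  true  = refl
  regroup : ∀ b e l o → (b + 2 * e) + (b * l + 2 * o) ≡ b * suc l + 2 * (e + o)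
  regroup = solve-∀

count-scale : ∀ x q n → count x Φ (q * 5) (n * 5) ≡ blockMin x * n + 2 * count x Φ q n
count-scale x q n = trans (cong (occ x) (factor-image q n))
  (trans (occ-φ x (factor Φ q n)) (cong (λ l → blockMin x * l + 2 * count x Φ q n) (length-factor Φ q n)))

-- Windows in Φ

record Seed (x : Letter) (A B ℓ : ℕ) : Set where
  field
    ordered   : A ≤ B
    letterA   : Φ A ≡ flip x
    letterB   : Φ B ≡ x
    followers : factor Φ (suc A) ℓ ≡ factor Φ (suc B) ℓ

-- φ(y) ends with the letters y 1, so position 5A + 3 carries Φ A, position 5A + 4
-- carries 1 whatever Φ A is, and the following blocks are the φ-image of the followers.
seed-step : ∀ {x A B ℓ} → Seed x A B ℓ → Seed x (3 + A * 5) (3 + B * 5) (suc (ℓ * 5))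
seed-step {x} {A} {B} {ℓ} seed = record
  { ordered   = +-monoʳ-≤ 3 (*-monoˡ-≤ 5 ordered)
  ; letterA   = trans (self-similarity A 3 r<5) (trans (fourth (Φ A)) letterA)
  ; letterB   = trans (self-similarity B 3 r<5) (trans (fourth (Φ B)) letterB)
  ; followers = trans (after A) (trans (cong (λ u → true ∷ φ u) followers) (sym (after B)))
  }
  where
  open Seed seed
  r<5 : 3 < 5
  r<5 = s≤s (s≤s (s≤s (s≤s z≤n)))
  fourth : ∀ y → nth (φ₁ y) 3 ≡ y
  fourth false = refl
  fourth true  = refl
  fifth : ∀ y → nth (φ₁ y) 4 ≡ true
  fifth false = refl
  fifth true  = refl
  after : ∀ P → factor Φ (4 + P * 5) (suc (ℓ * 5)) ≡ true ∷ φ (factor Φ (suc P) ℓ)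
  after P = cong₂ _∷_ (trans (self-similarity P 4 ≤-refl) (fifth (Φ P))) (factor-image (suc P) ℓ)

-- Seeds with arbitrarily many followers; Φ begins 0010, giving the seeds (0, 2) and (2, 3).
seed-exists : ∀ x ℓ → ∃[ A ] ∃[ B ] ∃[ ℓ' ] (ℓ ≤ ℓ' × Seed x A B ℓ')
seed-exists false zero = 2 , 3 , 0 , z≤n ,
  record { ordered = s≤s (s≤s z≤n) ; letterA = refl ; letterB = refl ; followers = refl }
seed-exists true  zero = 0 , 2 , 0 , z≤n ,
  record { ordered = z≤n ; letterA = refl ; letterB = refl ; followers = refl }
seed-exists x (suc ℓ) with seed-exists x ℓ
... | A , B , ℓ' , ℓ≤ℓ' , seed = _ , _ , _ , s≤s (≤-trans ℓ≤ℓ' (m≤m*n ℓ' 5)) , seed-step seed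

record Spread (x : Letter) (P₀ P₁ lo len D : ℕ) : Set where
  field
    ordered : P₀ ≤ P₁
    excess  : count x Φ P₁ lo ≡ D + count x Φ P₀ lo
    agree   : factor Φ (lo + P₀) len ≡ factor Φ (lo + P₁) len

seed-spread : ∀ {x A B ℓ} → Seed x A B ℓ → Spread x A B 1 ℓ 1
seed-spread {x} {A} {B} seed = record
  { ordered = Seed.ordered seed
  ; excess  = subst₂ (λ a b → δ x b + 0 ≡ 1 + (δ x a + 0)) (sym (Seed.letterA seed)) (sym (Seed.letterB seed)) (differ x)
  ; agree   = Seed.followers seed
  }
  where
  differ : ∀ x → δ x x + 0 ≡ 1 + (δ x (flip x) + 0)
  differ false = refl
  differ true  = refl

spread-scale : ∀ {x P₀ P₁ lo len D} → Spread x P₀ P₁ lo len D →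
               Spread x (P₀ * 5) (P₁ * 5) (lo * 5) (len * 5) (2 * D)
spread-scale {x} {P₀} {P₁} {lo} {len} {D} spread = record
  { ordered = *-monoˡ-≤ 5 ordered
  ; excess  = begin
      count x Φ (P₁ * 5) (lo * 5)                   ≡⟨ count-scale x P₁ lo ⟩
      blockMin x * lo + 2 * count x Φ P₁ lo         ≡⟨ cong (λ c → blockMin x * lo + 2 * c) excess ⟩
      blockMin x * lo + 2 * (D + count x Φ P₀ lo)   ≡⟨ regroup (blockMin x * lo) D (count x Φ P₀ lo) ⟩
      2 * D + (blockMin x * lo + 2 * count x Φ P₀ lo) ≡⟨ cong (2 * D +_) (sym (count-scale x P₀ lo)) ⟩
      2 * D + count x Φ (P₀ * 5) (lo * 5)           ∎
  ; agree   = trans (image P₀) (trans (cong φ agree) (sym (image P₁)))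
  }
  where
  open Spread spread
  open ≡-Reasoning
  regroup : ∀ b D c → b + 2 * (D + c) ≡ 2 * D + (b + 2 * c)
  regroup = solve-∀
  image : ∀ P → factor Φ (lo * 5 + P * 5) (len * 5) ≡ φ (factor Φ (lo + P) len)
  image P = trans (cong (λ i → factor Φ i (len * 5)) (sym (*-distribʳ-+ 5 lo P))) (factor-image (lo + P) len)

-- Spreads are gaps: the common continuation adds equally many x's to both windows.
spread-gap : ∀ {x P₀ P₁ lo len D} → Spread x P₀ P₁ lo len D → Gap x Φ D lo len P₀ P₁
spread-gap {x} {P₀} {P₁} {lo} {len} {D} spread = ordered , λ t t≤len → ≤-reflexive (sym (begin
    count x Φ P₁ (lo + t)                             ≡⟨ count-++ x Φ P₁ lo t ⟩
    count x Φ P₁ lo + count x Φ (lo + P₁) t           ≡⟨ cong₂ _+_ excess (cong (occ x) (sym (factor-prefix Φ _ _ len t t≤len agree))) ⟩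
    D + count x Φ P₀ lo + count x Φ (lo + P₀) t       ≡⟨ +-assoc D _ _ ⟩
    D + (count x Φ P₀ lo + count x Φ (lo + P₀) t)     ≡⟨ cong (D +_) (sym (count-++ x Φ P₀ lo t)) ⟩
    D + count x Φ P₀ (lo + t)                         ∎))
  where
  open Spread spread
  open ≡-Reasoning

spread-exists : ∀ x J len → ∃[ P₀ ] ∃[ P₁ ] ∃[ len' ] (len ≤ len' × Spread x P₀ P₁ (5 ^ J) len' (2 ^ J))
spread-exists x zero len with seed-exists x len
... | A , B , ℓ , len≤ℓ , seed = A , B , ℓ , len≤ℓ , seed-spread seed
spread-exists x (suc J) len with spread-exists x J len
... | P₀ , P₁ , len' , len≤ , spread = P₀ * 5 , P₁ * 5 , len' * 5 , ≤-trans len≤ (m≤m*n len' 5) ,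
  subst (λ lo → Spread x (P₀ * 5) (P₁ * 5) lo (len' * 5) (2 * 2 ^ J)) (*-comm (5 ^ J) 5) (spread-scale spread)

-- Φ has windows for both letters, since 2^D ≥ D.
Φ-windows : ∀ x → Windows x Φ
Φ-windows x D = 5 ^ D , gap-of
  where
  gap-of : ∀ len → ∃[ P₀ ] ∃[ P₁ ] Gap x Φ D (5 ^ D) len P₀ P₁
  gap-of len with spread-exists x D len
  ... | P₀ , P₁ , len' , len≤ , spread with spread-gap spread
  ...   | P₀≤P₁ , gap = P₀ , P₁ , P₀≤P₁ ,
          λ t t≤ → ≤-trans (+-monoˡ-≤ _ (<⇒≤ (n<b^n 2 ≤-refl D))) (gap t (≤-trans t≤ len≤))

theorem5 : FrobeniusProperty Φ
theorem5 a b gcd≡1 with weights a b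
... | x , p , d , same-gcd , S≡ with frobenius-counts (Φ-windows x) p d (trans same-gcd gcd≡1)
...   | N , represent = N , λ m N≤m → let j , n , eq = represent m N≤m in j , n , (begin
  S a b (factor Φ j n)                               ≡⟨ S≡ (factor Φ j n) ⟩
  p * length (factor Φ j n) + d * count x Φ j n      ≡⟨ cong (λ l → p * l + d * count x Φ j n) (length-factor Φ j n) ⟩
  p * n + d * count x Φ j n                          ≡⟨ eq ⟩
  m                                                  ∎)
  where open ≡-Reasoning
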